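{- Let $G$ be a torsion-free additive abelian group, let $h\geq 2$ be an integer, and let $k\geq 4$ be an integer. Then $$\mathcal{R}_{G}(h,k)\cap[hk-h+2,\,hk-1]=\varnothing.$$ That is, there is no subset $A\subseteq G$ with $|A|=k$ such that $hk-h+2\leq |hA|\leq hk-1$.
   Context: For an integer $h\geq 2$ and a subset $A$ of an additive abelian group $G$, the $h$-fold sumset is $hA=\{a_1+\cdots+a_h : a_1,\dots,a_h\in A\}$ (the $a_i$ need not be distinct). For a positive integer $k$, $\mathcal{R}_G(h,k)=\{|hA| : A\subseteq G,\ |A|=k\}$. For integers $a\le b$, $[a,b]$ denotes the set of integers $c$ with $a\leq c\leq b$. A group $G$ is torsion-free if for every nonzero $g\in G$ and every positive integer $n$, $ng\neq 0$. -}

module Defs where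

open import Level using (Level; _⊔_)
open import Data.Nat using (ℕ; zero; suc; _≤_)
open import Data.Fin using (Fin; zero; suc)
open import Data.Product using (Σ; ∃; _×_; _,_)
open import Relation.Nullary using (¬_)
open import Algebra.Bundles using (AbelianGroup)

module _ {c ℓ : Level} (G : AbelianGroup c ℓ) where
  open AbelianGroup G

  mult : ℕ → Carrier → Carrier
  mult zero    g = ε
  mult (suc n) g = g ∙ mult n g

  TorsionFree : Set (c ⊔ ℓ)
  TorsionFree = ∀ (g : Carrier) → ¬ (g ≈ ε) → ∀ (n : ℕ) → 1 ≤ n → ¬ (mult n g ≈ ε)

  sumFin : ∀ {n : ℕ} → (Fin n → Carrier) → Carrier
  sumFin {zero}  f = ε
  sumFin {suc n} f = f zero ∙ sumFin (λ i → f (suc i))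

  -- a k-element subset A of G, given as an injective enumeration a : Fin k → G
  Distinct : ∀ {k : ℕ} → (Fin k → Carrier) → Set ℓ
  Distinct {k} a = ∀ (i j : Fin k) → a i ≈ a j → i ≡ j
    where open import Relation.Binary.PropositionalEquality using (_≡_)

  InSumset : ∀ {k : ℕ} → ℕ → (Fin k → Carrier) → Carrier → Set ℓ
  InSumset {k} h a x = Σ (Fin h → Fin k) (λ f → x ≈ sumFin (λ i → a (f i)))

  HasCard : (Carrier → Set ℓ) → ℕ → Set (c ⊔ ℓ)
  HasCard S m =
    Σ (Fin m → Carrier) λ e →
      (∀ (i j : Fin m) → e i ≈ e j → i ≡ j) ×
      (∀ (i : Fin m) → S (e i)) ×
      (∀ (x : Carrier) → S x → ∃ λ (i : Fin m) → x ≈ e i)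
    where open import Relation.Binary.PropositionalEquality using (_≡_)

-- Up to double negation (membership in a rational span is not decidable),
-- some common multiple (1 + N)·aᵢ of the elements of A lies in the
-- span of an independent family b; after a common shift all coefficients are
-- natural numbers, and by torsion-freeness the coordinate map sends hA
-- bijectively onto hB for k distinct vectors B in ℕʳ, ordered
-- lexicographically and hence compatibly with addition.  So it suffices to
-- show |hB| ≤ h(k − 1) + 1 or |hB| ≥ hk for k distinct elements of a linearly
-- ordered commutative monoid, with minimum lo and maximum hi.
--   If every pair sum lies in (B ∙ lo) ∪ (B ∙ hi), every h-fold sum has the
-- form b ∙ s·lo ∙ t·hi with s + t = h − 1, and there are at most h(k − 1) + 1
-- of these.  Otherwise some pair sum x avoids both translates; say
-- x > lo ∙ hi.  Then L₁ = B and
--   L_{j+1} = (lo ∙ L_j) ∪ {x ∙ (j − 1)·hi} ∪ {b ∙ j·hi : b ≠ lo}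
-- consist of distinct (j+1)-fold sums: lo ∙ L_j lies weakly below lo ∙ j·hi
-- and the k new elements strictly above it.  Hence |hB| ≥ |L_h| = hk.

module Submission where

open import Level using (Level; _⊔_; 0ℓ) renaming (suc to lsuc)
open import Algebra using (Op₂; CommutativeMonoid; IsCommutativeMonoid)
open import Algebra.Bundles using (AbelianGroup)
open import Data.Empty using (⊥-elim)
open import Data.Fin using (Fin; zero; suc; punchIn; punchOut)
open import Data.Fin.Properties
  using (injective⇒≤; any?; all?; ¬∀⟶∃¬; punchIn-injective; punchInᵢ≢i; punchIn-punchOut)
  renaming (_≟_ to _≟ᶠ_)
open import Data.List using (List; _∷_; _++_; map; tabulate; length; lookup)
open import Data.List.Properties using (length-++; length-map; length-tabulate)
open import Data.List.Membership.Propositional using (_∈_)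
open import Data.List.Membership.Propositional.Properties
  using (∈-lookup; ∈-map⁺; ∈-++⁺ˡ; ∈-++⁺ʳ; ∈-tabulate⁺; ∈-tabulate⁻)
import Data.List.Membership.Setoid.Properties as SetoidMembership
open import Data.List.Relation.Binary.Disjoint.Propositional using (Disjoint)
open import Data.List.Relation.Binary.Subset.Propositional using (_⊆_)
open import Data.List.Relation.Unary.All as All using (All; _∷_)
import Data.List.Relation.Unary.All.Properties as All
open import Data.List.Relation.Unary.AllPairs using (_∷_)
open import Data.List.Relation.Unary.Any using (index)
open import Data.List.Relation.Unary.Unique.Propositional using (Unique)
import Data.List.Relation.Unary.Unique.Propositional.Properties as Unique
open import Data.Nat using (ℕ; zero; suc; _≤_; _+_; _*_; _∸_)
import Data.Nat as ℕ
open import Data.Nat.Properties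
  using (+-comm; +-assoc; +-suc; +-identityˡ; +-identityʳ; *-comm; suc-injective)
import Data.Nat.Properties as ℕₚ
open import Data.Product using (_×_; _,_; ∃; ∃₂; map₁; proj₁; proj₂)
open import Data.Sum as Sum using (_⊎_; inj₁; inj₂; map₂)
open import Data.Vec as Vec using (Vec; []; _∷_; zipWith; replicate)
open import Data.Vec.Properties using (zipWith-assoc; zipWith-comm; zipWith-identityˡ; zipWith-identityʳ)
open import Data.Vec.Relation.Binary.Lex.Strict as Lex using (Lex-<; this; next)
open import Data.Vec.Relation.Binary.Pointwise.Inductive using (Pointwise-≡⇒≡; ≡⇒Pointwise-≡)
open import Function using (_∘_; flip; Injective)
open import Relation.Binary using (Rel; IsEquivalence; IsStrictTotalOrder; Trichotomous; tri<; tri≈; tri>)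
open import Relation.Binary.Structures.Biased using (isStrictTotalOrderᶜ)
import Relation.Binary.Construct.Flip.EqAndOrd as Flip
import Relation.Binary.Construct.StrictToNonStrict as StrictToNonStrict
open import Relation.Binary.PropositionalEquality as ≡ using (_≡_; _≢_)
open import Relation.Nullary using (¬_; yes; no; Dec)
open import Relation.Nullary.Decidable using (_⊎-dec_; decidable-stable; ¬¬-excluded-middle)
open import Relation.Nullary.Negation using (¬¬-map)

open import Defs

lookup-injective : ∀ {a} {A : Set a} {xs : List A} → Unique xs →
                   ∀ {i j} → lookup xs i ≡ lookup xs j → i ≡ j
lookup-injective (_ ∷ _) {zero} {zero} _ = ≡.refl
lookup-injective (x∉xs ∷ _) {zero} {suc j} eq = ⊥-elim (All.lookup x∉xs (∈-lookup j) eq)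
lookup-injective (x∉xs ∷ _) {suc i} {zero} eq = ⊥-elim (All.lookup x∉xs (∈-lookup i) (≡.sym eq))
lookup-injective (_ ∷ xs!) {suc i} {suc j} eq = ≡.cong suc (lookup-injective xs! eq)

unique-⊆⇒length-≤ : ∀ {a} {A : Set a} {xs ys : List A} → Unique xs → xs ⊆ ys → length xs ≤ length ys
unique-⊆⇒length-≤ {A = A} {xs} xs! xs⊆ys = injective⇒≤ position-injective
  where
  position : Fin (length xs) → Fin _
  position i = index (xs⊆ys (∈-lookup i))

  position-injective : Injective _≡_ _≡_ position
  position-injective {i} {j} =
    lookup-injective xs!
      ∘ SetoidMembership.index-injective (≡.setoid A) (xs⊆ys (∈-lookup i)) (xs⊆ys (∈-lookup j))

module Sumsets {a} {V : Set a} {_∙_ : Op₂ V} {ε : V}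
  (isCommutativeMonoid : IsCommutativeMonoid _≡_ _∙_ ε) where

  open ≡ using (refl; sym; trans; cong; cong₂; subst; subst₂; isEquivalence; module ≡-Reasoning)

  commutativeMonoid : CommutativeMonoid a a
  commutativeMonoid = record { isCommutativeMonoid = isCommutativeMonoid }

  open CommutativeMonoid commutativeMonoid using (rawMonoid; assoc; comm; identityˡ; identityʳ)
  open import Algebra.Definitions.RawMonoid rawMonoid public using (sum)
  open import Algebra.Properties.CommutativeMonoid.Mult commutativeMonoid using () renaming (_×_ to infixr 25 _·_)
  open import Algebra.Properties.CommutativeSemigroup (CommutativeMonoid.commutativeSemigroup commutativeMonoid)
    using (x∙yz≈y∙xz)
  open import Algebra.Solver.CommutativeMonoid commutativeMonoid using (solve; _⊜_; _⊕_)

  module _ {k} (B : Fin k → V) where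

    IsSumOf : ℕ → V → Set a
    IsSumOf n v = ∃ λ (w : Fin n → Fin k) → sum (B ∘ w) ≡ v

    IsSumOf-∷ : ∀ i {n v} → IsSumOf n v → IsSumOf (suc n) (B i ∙ v)
    IsSumOf-∷ i (w , refl) = (λ { zero → i ; (suc t) → w t }) , refl

    IsSumOf-1 : ∀ i → IsSumOf 1 (B i)
    IsSumOf-1 i = (λ _ → i) , identityʳ (B i)

    IsSumOf-· : ∀ n i → IsSumOf n (n · B i)
    IsSumOf-· zero    i = (λ ()) , refl
    IsSumOf-· (suc n) i = IsSumOf-∷ i (IsSumOf-· n i)

    record SumsetEnumeration (n m : ℕ) : Set a where
      field
        element   : Fin m → V
        injective : Injective _≡_ _≡_ element
        sound     : ∀ i → IsSumOf n (element i)
        complete  : ∀ {v} → IsSumOf n v → ∃ λ i → v ≡ element i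

    record SumsetAtLeast (n size : ℕ) : Set a where
      field
        elements : List V
        unique   : Unique elements
        sums     : All (IsSumOf n) elements
        length≡  : length elements ≡ size

    record SumsetAtMost (n size : ℕ) : Set a where
      field
        elements : List V
        covers   : ∀ {v} → IsSumOf n v → v ∈ elements
        length≡  : length elements ≡ size

    module _ {n m} (E : SumsetEnumeration n m) where
      open SumsetEnumeration E

      atLeast⇒≤ : ∀ {size} → SumsetAtLeast n size → size ≤ m
      atLeast⇒≤ L = subst₂ _≤_ length≡ (length-tabulate element)
        (unique-⊆⇒length-≤ unique λ v∈L → enumerated (complete (All.lookup sums v∈L)))
        where
        open SumsetAtLeast L
        enumerated : ∀ {v} → ∃ (λ i → v ≡ element i) → v ∈ tabulate element
        enumerated (i , refl) = ∈-tabulate⁺ i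

      atMost⇒≥ : ∀ {size} → SumsetAtMost n size → m ≤ size
      atMost⇒≥ U = subst₂ _≤_ (length-tabulate element) length≡
        (unique-⊆⇒length-≤ (Unique.tabulate⁺ injective) (covers ∘ sound-∈))
        where
        open SumsetAtMost U
        sound-∈ : ∀ {v} → v ∈ tabulate element → IsSumOf n v
        sound-∈ v∈ with ∈-tabulate⁻ v∈
        ... | i , refl = sound i

  InTranslates : ∀ {k} (B : Fin k → V) (ilo ihi : Fin k) → V → Set a
  InTranslates B ilo ihi v = ∃ λ i → v ≡ B i ∙ B ilo ⊎ v ≡ B i ∙ B ihi

  module PairClosed {k} (B : Fin (suc k) → V) (ilo ihi : Fin (suc k))
    (closed : ∀ p q → InTranslates B ilo ihi (B p ∙ B q)) where

    lo hi : V
    lo = B ilo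
    hi = B ihi

    above-lo : ℕ → Fin k → V
    above-lo j i = B (punchIn ilo i) ∙ suc j · hi

    U : ℕ → List V
    U zero    = tabulate B
    U (suc j) = map (lo ∙_) (U j) ++ tabulate (above-lo j)

    length-U : ∀ j → length (U j) ≡ suc (suc j * k)
    length-U zero    = trans (length-tabulate B) (cong suc (sym (+-identityʳ k)))
    length-U (suc j) = begin
      length (map (lo ∙_) (U j) ++ tabulate (above-lo j))
        ≡⟨ length-++ (map (lo ∙_) (U j)) ⟩
      length (map (lo ∙_) (U j)) + length (tabulate (above-lo j))
        ≡⟨ cong₂ _+_ (trans (length-map (lo ∙_) (U j)) (length-U j)) (length-tabulate (above-lo j)) ⟩
      suc (suc j * k) + k
        ≡⟨ cong suc (+-comm (suc j * k) k) ⟩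
      suc (suc (suc j) * k)
        ∎
      where open ≡-Reasoning

    NormalForm : ℕ → V → Set a
    NormalForm j v = ∃₂ λ s t → s + t ≡ j × ∃ λ i → v ≡ B i ∙ (s · lo ∙ t · hi)

    normal-form : ∀ j {v} → IsSumOf B (suc j) v → NormalForm j v
    normal-form zero    (w , refl) = 0 , 0 , refl , w zero , cong (B (w zero) ∙_) (sym (identityˡ ε))
    normal-form (suc j) (w , refl) with normal-form j ((w ∘ suc) , refl)
    ... | s , t , s+t≡j , i , eq with closed (w zero) i
    ...   | i′ , inj₁ eq′ = suc s , t , cong suc s+t≡j , i′ , (begin
      B (w zero) ∙ sum (B ∘ w ∘ suc)
        ≡⟨ cong (B (w zero) ∙_) eq ⟩
      B (w zero) ∙ (B i ∙ (s · lo ∙ t · hi))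
        ≡⟨ assoc _ _ _ ⟨
      (B (w zero) ∙ B i) ∙ (s · lo ∙ t · hi)
        ≡⟨ cong (_∙ (s · lo ∙ t · hi)) eq′ ⟩
      (B i′ ∙ lo) ∙ (s · lo ∙ t · hi)
        ≡⟨ solve 4 (λ y l S T → (y ⊕ l) ⊕ (S ⊕ T) ⊜ y ⊕ ((l ⊕ S) ⊕ T)) refl (B i′) lo (s · lo) (t · hi) ⟩
      B i′ ∙ (suc s · lo ∙ t · hi)
        ∎)
      where open ≡-Reasoning
    ...   | i′ , inj₂ eq′ = s , suc t , trans (+-suc s t) (cong suc s+t≡j) , i′ , (begin
      B (w zero) ∙ sum (B ∘ w ∘ suc)
        ≡⟨ cong (B (w zero) ∙_) eq ⟩
      B (w zero) ∙ (B i ∙ (s · lo ∙ t · hi))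
        ≡⟨ assoc _ _ _ ⟨
      (B (w zero) ∙ B i) ∙ (s · lo ∙ t · hi)
        ≡⟨ cong (_∙ (s · lo ∙ t · hi)) eq′ ⟩
      (B i′ ∙ hi) ∙ (s · lo ∙ t · hi)
        ≡⟨ solve 4 (λ y h S T → (y ⊕ h) ⊕ (S ⊕ T) ⊜ y ⊕ (S ⊕ (h ⊕ T))) refl (B i′) hi (s · lo) (t · hi) ⟩
      B i′ ∙ (s · lo ∙ suc t · hi)
        ∎)
      where open ≡-Reasoning

    normal∈U : ∀ j {v} → NormalForm j v → v ∈ U j
    normal∈U zero (zero , zero , refl , i , refl) =
      subst (_∈ U zero) (trans (sym (identityʳ (B i))) (cong (B i ∙_) (sym (identityˡ ε))))
        (∈-tabulate⁺ {f = B} i)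
    normal∈U (suc j) (suc s , t , s+t≡ , i , refl) =
      subst (_∈ U (suc j))
        (solve 4 (λ y l S T → l ⊕ (y ⊕ (S ⊕ T)) ⊜ y ⊕ ((l ⊕ S) ⊕ T)) refl (B i) lo (s · lo) (t · hi))
        (∈-++⁺ˡ (∈-map⁺ (lo ∙_) (normal∈U j (s , t , suc-injective s+t≡ , i , refl))))
    normal∈U (suc j) (zero , t , refl , i , refl) with i ≟ᶠ ilo
    ... | yes refl =
      subst (_∈ U (suc j)) (cong (lo ∙_) (x∙yz≈y∙xz hi ε (j · hi)))
        (∈-++⁺ˡ (∈-map⁺ (lo ∙_) (normal∈U j (zero , j , refl , ihi , refl))))
    ... | no i≢ilo =
      subst (_∈ U (suc j)) (cong₂ _∙_ (cong B (punchIn-punchOut (i≢ilo ∘ sym))) (sym (identityˡ _)))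
        (∈-++⁺ʳ (map (lo ∙_) (U j)) (∈-tabulate⁺ (punchOut (i≢ilo ∘ sym))))

    atMost : ∀ j → SumsetAtMost B (suc j) (suc (suc j * k))
    atMost j = record { elements = U j ; covers = normal∈U j ∘ normal-form j ; length≡ = length-U j }

  record CompatibleStrictTotalOrder ℓ : Set (a ⊔ lsuc ℓ) where
    infix 4 _<_
    field
      _<_                : Rel V ℓ
      isStrictTotalOrder : IsStrictTotalOrder _≡_ _<_
      ∙-monoˡ-<          : ∀ z {x y} → x < y → (x ∙ z) < (y ∙ z)

  reverse : ∀ {ℓ} → CompatibleStrictTotalOrder ℓ → CompatibleStrictTotalOrder ℓ
  reverse O = record
    { _<_                = flip _<_
    ; isStrictTotalOrder = Flip.isStrictTotalOrder isStrictTotalOrder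
    ; ∙-monoˡ-<          = λ z y<x → ∙-monoˡ-< z y<x
    } where open CompatibleStrictTotalOrder O

  module OrderProperties {ℓ} (O : CompatibleStrictTotalOrder ℓ) where
    open CompatibleStrictTotalOrder O public
    open IsStrictTotalOrder isStrictTotalOrder public
      using (compare; _≟_; <-respˡ-≈; <-resp-≈) renaming (trans to <-trans; irrefl to <-irrefl)
    open StrictToNonStrict _≡_ _<_ public using () renaming (_≤_ to infix 4 _≼_)

    ≼-trans : ∀ {x y z} → x ≼ y → y ≼ z → x ≼ z
    ≼-trans = StrictToNonStrict.trans _≡_ _<_ isEquivalence <-resp-≈ <-trans

    ≼-<-trans : ∀ {x y z} → x ≼ y → y < z → x < z
    ≼-<-trans = StrictToNonStrict.≤-<-trans _≡_ _<_ sym <-trans <-respˡ-≈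

    ≼∧≢⇒< : ∀ {x y} → x ≼ y → x ≢ y → x < y
    ≼∧≢⇒< (inj₁ x<y) _   = x<y
    ≼∧≢⇒< (inj₂ x≡y) x≢y = ⊥-elim (x≢y x≡y)

    ∙-monoʳ-< : ∀ z {x y} → x < y → (z ∙ x) < (z ∙ y)
    ∙-monoʳ-< z {x} {y} x<y = subst₂ _<_ (comm x z) (comm y z) (∙-monoˡ-< z x<y)

    ∙-monoˡ-≼ : ∀ z {x y} → x ≼ y → (x ∙ z) ≼ (y ∙ z)
    ∙-monoˡ-≼ z (inj₁ x<y)  = inj₁ (∙-monoˡ-< z x<y)
    ∙-monoˡ-≼ z (inj₂ refl) = inj₂ refl

    ∙-monoʳ-≼ : ∀ z {x y} → x ≼ y → (z ∙ x) ≼ (z ∙ y)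
    ∙-monoʳ-≼ z (inj₁ x<y)  = inj₁ (∙-monoʳ-< z x<y)
    ∙-monoʳ-≼ z (inj₂ refl) = inj₂ refl

    ∙-mono-≼ : ∀ {x y u v} → x ≼ y → u ≼ v → (x ∙ u) ≼ (y ∙ v)
    ∙-mono-≼ {y = y} {u} x≼y u≼v = ≼-trans (∙-monoˡ-≼ u x≼y) (∙-monoʳ-≼ y u≼v)

    ∙-cancelʳ : ∀ z {x y} → (x ∙ z) ≡ (y ∙ z) → x ≡ y
    ∙-cancelʳ z {x} {y} eq with compare x y
    ... | tri< x<y _ _ = ⊥-elim (<-irrefl eq (∙-monoˡ-< z x<y))
    ... | tri≈ _ x≡y _ = x≡y
    ... | tri> _ _ y<x = ⊥-elim (<-irrefl (sym eq) (∙-monoˡ-< z y<x))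

    ∙-cancelˡ : ∀ z {x y} → (z ∙ x) ≡ (z ∙ y) → x ≡ y
    ∙-cancelˡ z {x} {y} eq = ∙-cancelʳ z (trans (comm x z) (trans eq (comm z y)))

    minimum : ∀ {n} (f : Fin (suc n) → V) → ∃ λ i → ∀ j → f i ≼ f j
    minimum {zero}  f = zero , λ { zero → inj₂ refl }
    minimum {suc n} f with minimum (f ∘ suc)
    ... | i , fi≼ with StrictToNonStrict.total _≡_ _<_ compare (f zero) (f (suc i))
    ...   | inj₁ f0≼fi = zero  , λ { zero → inj₂ refl ; (suc j) → ≼-trans f0≼fi (fi≼ j) }
    ...   | inj₂ fi≼f0 = suc i , λ { zero → fi≼f0 ; (suc j) → fi≼ j }

    separated⇒disjoint : ∀ c {xs ys} → All (_≼ c) xs → All (c <_) ys → Disjoint xs ys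
    separated⇒disjoint c xs≼c c<ys (v∈xs , v∈ys) =
      <-irrefl refl (≼-<-trans (All.lookup xs≼c v∈xs) (All.lookup c<ys v∈ys))

  module Layers {ℓ} (O : CompatibleStrictTotalOrder ℓ) where
    open OrderProperties O

    module _ {k} (B : Fin (suc k) → V) (B-injective : Injective _≡_ _≡_ B)
      (ilo ihi : Fin (suc k)) (lo-min : ∀ i → B ilo ≼ B i) (hi-max : ∀ i → B i ≼ B ihi)
      (p q : Fin (suc k)) (lo∙hi<x : B ilo ∙ B ihi < B p ∙ B q)
      (x∉B∙hi : ∀ i → B p ∙ B q ≢ B i ∙ B ihi) where

      lo hi x : V
      lo = B ilo
      hi = B ihi
      x  = B p ∙ B q

      above-lo : ℕ → Fin k → V
      above-lo j i = B (punchIn ilo i) ∙ suc j · hi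

      top : ℕ → List V
      top j = (x ∙ j · hi) ∷ tabulate (above-lo j)

      L : ℕ → List V
      L zero    = tabulate B
      L (suc j) = map (lo ∙_) (L j) ++ top j

      length-L : ∀ j → length (L j) ≡ suc j * suc k
      length-L zero    = trans (length-tabulate B) (sym (+-identityʳ (suc k)))
      length-L (suc j) = begin
        length (map (lo ∙_) (L j) ++ top j)          ≡⟨ length-++ (map (lo ∙_) (L j)) ⟩
        length (map (lo ∙_) (L j)) + length (top j)  ≡⟨ cong₂ _+_ (trans (length-map (lo ∙_) (L j)) (length-L j))
                                                                    (cong suc (length-tabulate (above-lo j))) ⟩
        suc j * suc k + suc k                        ≡⟨ +-comm (suc j * suc k) (suc k) ⟩
        suc (suc j) * suc k                          ∎
        where open ≡-Reasoning

      L-sums : ∀ j → All (IsSumOf B (suc j)) (L j)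
      L-sums zero    = All.tabulate⁺ (IsSumOf-1 B)
      L-sums (suc j) = All.++⁺ (All.map⁺ (All.map (IsSumOf-∷ B ilo) (L-sums j)))
                               (x-sum ∷ All.tabulate⁺ λ i → IsSumOf-∷ B (punchIn ilo i) (IsSumOf-· B (suc j) ihi))
        where
        x-sum : IsSumOf B (suc (suc j)) (x ∙ j · hi)
        x-sum = subst (IsSumOf B _) (sym (assoc (B p) (B q) (j · hi)))
                      (IsSumOf-∷ B p (IsSumOf-∷ B q (IsSumOf-· B j ihi)))

      sum≼·hi : ∀ {n v} → IsSumOf B n v → v ≼ n · hi
      sum≼·hi {zero}  (w , refl) = inj₂ refl
      sum≼·hi {suc n} (w , refl) = ∙-mono-≼ (hi-max (w zero)) (sum≼·hi ((w ∘ suc) , refl))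

      lo<other : ∀ i → lo < B (punchIn ilo i)
      lo<other i = ≼∧≢⇒< (lo-min (punchIn ilo i)) (punchInᵢ≢i ilo i ∘ sym ∘ B-injective)

      top-unique : ∀ j → Unique (top j)
      top-unique j = All.tabulate⁺ x-new
                   ∷ Unique.tabulate⁺ (punchIn-injective ilo _ _ ∘ B-injective ∘ ∙-cancelʳ (suc j · hi))
        where
        x-new : ∀ i → x ∙ j · hi ≢ above-lo j i
        x-new i eq = x∉B∙hi (punchIn ilo i) (∙-cancelʳ (j · hi) (trans eq (sym (assoc _ hi (j · hi)))))

      L-unique : ∀ j → Unique (L j)
      L-unique zero    = Unique.tabulate⁺ B-injective
      L-unique (suc j) = Unique.++⁺ (Unique.map⁺ (∙-cancelˡ lo) (L-unique j)) (top-unique j)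
                                    (separated⇒disjoint (lo ∙ suc j · hi) below above)
        where
        below : All (_≼ (lo ∙ suc j · hi)) (map (lo ∙_) (L j))
        below = All.map⁺ (All.map (∙-monoʳ-≼ lo ∘ sum≼·hi) (L-sums j))

        above : All ((lo ∙ suc j · hi) <_) (top j)
        above = subst (_< x ∙ j · hi) (assoc lo hi (j · hi)) (∙-monoˡ-< (j · hi) lo∙hi<x)
              ∷ All.tabulate⁺ (λ i → ∙-monoˡ-< (suc j · hi) (lo<other i))

      atLeast : ∀ j → SumsetAtLeast B (suc j) (suc j * suc k)
      atLeast j = record { elements = L j ; unique = L-unique j ; sums = L-sums j ; length≡ = length-L j }

  module _ {ℓ} (O : CompatibleStrictTotalOrder ℓ)
    {k} (B : Fin (suc k) → V) (B-injective : Injective _≡_ _≡_ B) where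
    open OrderProperties O

    inTranslates? : ∀ ilo ihi v → Dec (InTranslates B ilo ihi v)
    inTranslates? ilo ihi v = any? λ i → (v ≟ B i ∙ B ilo) ⊎-dec (v ≟ B i ∙ B ihi)

    closed-or-exceptional : ∀ ilo ihi → (∀ p q → InTranslates B ilo ihi (B p ∙ B q))
                                      ⊎ ∃₂ λ p q → ¬ InTranslates B ilo ihi (B p ∙ B q)
    closed-or-exceptional ilo ihi with all? (λ p → all? λ q → inTranslates? ilo ihi (B p ∙ B q))
    ... | yes closed = inj₁ closed
    ... | no ¬closed with ¬∀⟶∃¬ _ _ (λ p → all? λ q → inTranslates? ilo ihi (B p ∙ B q)) ¬closed
    ...   | p , ¬closed-p with ¬∀⟶∃¬ _ _ (λ q → inTranslates? ilo ihi (B p ∙ B q)) ¬closed-p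
    ...     | q , exceptional = inj₂ (p , q , exceptional)

    maximum : ∀ {n} (f : Fin (suc n) → V) → ∃ λ i → ∀ j → f j ≼ f i
    maximum f with OrderProperties.minimum (reverse O) f
    ... | i , f≽fi = i , map₂ sym ∘ f≽fi

    exceptional⇒atLeast : ∀ {ilo ihi} → (∀ i → B ilo ≼ B i) → (∀ i → B i ≼ B ihi) →
                          ∀ {p q} → ¬ InTranslates B ilo ihi (B p ∙ B q) →
                          ∀ h → SumsetAtLeast B (suc h) (suc h * suc k)
    exceptional⇒atLeast {ilo} {ihi} lo-min hi-max {p} {q} exceptional with compare (B ilo ∙ B ihi) (B p ∙ B q)
    ... | tri< lo∙hi<x _ _ =
      Layers.atLeast O B B-injective ilo ihi lo-min hi-max p q lo∙hi<x (λ i → exceptional ∘ (i ,_) ∘ inj₂)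
    ... | tri≈ _ lo∙hi≡x _ = ⊥-elim (exceptional (ihi , inj₁ (trans (sym lo∙hi≡x) (comm (B ilo) (B ihi)))))
    -- x < lo ∙ hi: build the layers in the reversed order, where lo and hi trade places
    ... | tri> _ _ x<lo∙hi =
      Layers.atLeast (reverse O) B B-injective ihi ilo (map₂ sym ∘ hi-max) (map₂ sym ∘ lo-min) p q
        (subst (B p ∙ B q <_) (comm (B ilo) (B ihi)) x<lo∙hi) (λ i → exceptional ∘ (i ,_) ∘ inj₁)

    dichotomy : ∀ h → SumsetAtLeast B (suc h) (suc h * suc k) ⊎ SumsetAtMost B (suc h) (suc (suc h * k))
    dichotomy h with minimum B | maximum B
    ... | ilo , lo-min | ihi , hi-max with closed-or-exceptional ilo ihi
    ...   | inj₁ closed                = inj₂ (PairClosed.atMost B ilo ihi closed h)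
    ...   | inj₂ (p , q , exceptional) = inj₁ (exceptional⇒atLeast lo-min hi-max exceptional h)

infixl 6 _+ᵥ_
_+ᵥ_ : ∀ {r} → Vec ℕ r → Vec ℕ r → Vec ℕ r
_+ᵥ_ = zipWith _+_

infixr 7 _·ᵥ_
_·ᵥ_ : ∀ {r} → ℕ → Vec ℕ r → Vec ℕ r
n ·ᵥ u = Vec.map (n *_) u

0ᵥ : ∀ {r} → Vec ℕ r
0ᵥ = replicate _ 0

+ᵥ-comm : ∀ {r} (u v : Vec ℕ r) → u +ᵥ v ≡ v +ᵥ u
+ᵥ-comm = zipWith-comm +-comm

+ᵥ-isCommutativeMonoid : ∀ {r} → IsCommutativeMonoid _≡_ (_+ᵥ_ {r}) 0ᵥ
+ᵥ-isCommutativeMonoid = record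
  { isMonoid = record
    { isSemigroup = record
      { isMagma = record { isEquivalence = ≡.isEquivalence ; ∙-cong = ≡.cong₂ _+ᵥ_ }
      ; assoc   = zipWith-assoc +-assoc
      }
    ; identity = zipWith-identityˡ +-identityˡ , zipWith-identityʳ +-identityʳ
    }
  ; comm = +ᵥ-comm
  }

infix 4 _<ˡᵉˣ_
_<ˡᵉˣ_ : ∀ {r} → Rel (Vec ℕ r) 0ℓ
_<ˡᵉˣ_ = Lex-< _≡_ ℕ._<_

<ˡᵉˣ-isStrictTotalOrder : ∀ {r} → IsStrictTotalOrder _≡_ (_<ˡᵉˣ_ {r})
<ˡᵉˣ-isStrictTotalOrder = isStrictTotalOrderᶜ record
  { isEquivalence = ≡.isEquivalence
  ; trans         = Lex.<-trans (IsEquivalence.isPartialEquivalence ≡.isEquivalence) ℕₚ.<-resp₂-≡ ℕₚ.<-trans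
  ; compare       = compare
  }
  where
  compare : Trichotomous _≡_ _<ˡᵉˣ_
  compare u v with Lex.<-cmp ≡.sym ℕₚ.<-cmp u v
  ... | tri< u<v u≉v u≯v = tri< u<v (u≉v ∘ ≡⇒Pointwise-≡) u≯v
  ... | tri≈ u≮v u≈v u≯v = tri≈ u≮v (Pointwise-≡⇒≡ u≈v) u≯v
  ... | tri> u≮v u≉v u>v = tri> u≮v (u≉v ∘ ≡⇒Pointwise-≡) u>v

+ᵥ-monoˡ-<ˡᵉˣ : ∀ {r} (w : Vec ℕ r) {u v} → u <ˡᵉˣ v → u +ᵥ w <ˡᵉˣ v +ᵥ w
+ᵥ-monoˡ-<ˡᵉˣ (z ∷ w) (this x<y ≡.refl) = this (ℕₚ.+-monoˡ-< z x<y) ≡.refl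
+ᵥ-monoˡ-<ˡᵉˣ (z ∷ w) (next ≡.refl u<v) = next ≡.refl (+ᵥ-monoˡ-<ˡᵉˣ w u<v)

lexicographic : ∀ {r} → Sumsets.CompatibleStrictTotalOrder (+ᵥ-isCommutativeMonoid {r}) 0ℓ
lexicographic = record
  { isStrictTotalOrder = <ˡᵉˣ-isStrictTotalOrder
  ; ∙-monoˡ-<          = +ᵥ-monoˡ-<ˡᵉˣ
  }

module _ {c ℓ} (G : AbelianGroup c ℓ) where
  open AbelianGroup G
  open import Algebra.Properties.AbelianGroup G using (∙-cancelˡ; ∙-cancelʳ; x∙y⁻¹≈ε⇒x≈y)
  open import Algebra.Properties.CommutativeMonoid.Mult commutativeMonoid
    using (×-congʳ; ×-homo-+; ×-assocˡ; ×-distrib-+) renaming (_×_ to infixr 8 _·_)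
  open import Algebra.Properties.CommutativeSemigroup commutativeSemigroup using (interchange)
  open import Relation.Binary.Reasoning.Setoid setoid

  mult≈· : ∀ n g → mult G n g ≈ n · g
  mult≈· zero    g = refl
  mult≈· (suc n) g = ∙-congˡ (mult≈· n g)

  ·-ε : ∀ n → n · ε ≈ ε
  ·-ε zero    = refl
  ·-ε (suc n) = trans (identityˡ _) (·-ε n)

  ·-∙⁻¹ : ∀ n {x y} → n · x ≈ n · y → n · (x ∙ y ⁻¹) ≈ ε
  ·-∙⁻¹ n {x} {y} nx≈ny = begin
    n · (x ∙ y ⁻¹)        ≈⟨ ×-distrib-+ x (y ⁻¹) n ⟩
    n · x ∙ n · (y ⁻¹)    ≈⟨ ∙-congʳ nx≈ny ⟩
    n · y ∙ n · (y ⁻¹)    ≈⟨ ×-distrib-+ y (y ⁻¹) n ⟨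
    n · (y ∙ y ⁻¹)        ≈⟨ ×-congʳ n (inverseʳ y) ⟩
    n · ε                 ≈⟨ ·-ε n ⟩
    ε                     ∎

  ·-injective : TorsionFree G → ∀ n {x y} → suc n · x ≈ suc n · y → ¬ ¬ x ≈ y
  ·-injective tf n {x} {y} nx≈ny x≉y =
    tf (x ∙ y ⁻¹) (x≉y ∘ x∙y⁻¹≈ε⇒x≈y x y) (suc n) (ℕ.s≤s ℕ.z≤n)
       (trans (mult≈· (suc n) _) (·-∙⁻¹ (suc n) nx≈ny))

  lin : ∀ {r} → Vec ℕ r → Vec Carrier r → Carrier
  lin []       []       = ε
  lin (c ∷ cs) (g ∷ gs) = c · g ∙ lin cs gs

  lin-0 : ∀ {r} (b : Vec Carrier r) → lin 0ᵥ b ≈ ε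
  lin-0 []      = refl
  lin-0 (g ∷ b) = trans (identityˡ _) (lin-0 b)

  lin-+ : ∀ {r} (u v : Vec ℕ r) b → lin (u +ᵥ v) b ≈ lin u b ∙ lin v b
  lin-+ []      []      []      = sym (identityˡ ε)
  lin-+ (c ∷ u) (d ∷ v) (g ∷ b) = begin
    (c + d) · g ∙ lin (u +ᵥ v) b            ≈⟨ ∙-cong (×-homo-+ g c d) (lin-+ u v b) ⟩
    (c · g ∙ d · g) ∙ (lin u b ∙ lin v b)   ≈⟨ interchange _ _ _ _ ⟩
    (c · g ∙ lin u b) ∙ (d · g ∙ lin v b)   ∎

  lin-· : ∀ {r} n (u : Vec ℕ r) b → lin (n ·ᵥ u) b ≈ n · lin u b
  lin-· n []      []      = sym (·-ε n)
  lin-· n (c ∷ u) (g ∷ b) = begin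
    (n * c) · g ∙ lin (n ·ᵥ u) b   ≈⟨ ∙-cong (sym (×-assocˡ g n c)) (lin-· n u b) ⟩
    n · (c · g) ∙ n · lin u b      ≈⟨ ×-distrib-+ (c · g) (lin u b) n ⟨
    n · (c · g ∙ lin u b)          ∎

  Independent : ∀ {r} → Vec Carrier r → Set ℓ
  Independent b = ∀ u v → lin u b ≈ lin v b → u ≡ v

  InRationalSpan : ∀ {r} → Vec Carrier r → Carrier → Set ℓ
  InRationalSpan b x = ∃ λ n → ∃₂ λ u v → suc n · x ∙ lin u b ≈ lin v b

  -- Shifting all aᵢ by the same combination lets their coordinates be natural numbers.
  record Coordinates {n} (a : Fin n → Carrier) : Set (c ⊔ ℓ) where
    field
      {rank}      : ℕ
      basis       : Vec Carrier rank
      independent : Independent basis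
      scale       : ℕ
      shift       : Vec ℕ rank
      coords      : Fin n → Vec ℕ rank
      represents  : ∀ i → suc scale · a i ∙ lin shift basis ≈ lin (coords i) basis

  multiples-cancel : ∀ {r} {b : Vec Carrier r} {x} → ¬ InRationalSpan b x →
                     ∀ c d u v → c · x ∙ lin u b ≈ d · x ∙ lin v b → c ≡ d × lin u b ≈ lin v b
  multiples-cancel x∉ zero    zero    u v eq = ≡.refl , ∙-cancelˡ ε _ _ eq
  multiples-cancel x∉ (suc c) zero    u v eq = ⊥-elim (x∉ (c , u , v , trans eq (identityˡ _)))
  multiples-cancel x∉ zero    (suc d) u v eq = ⊥-elim (x∉ (d , v , u , trans (sym eq) (identityˡ _)))
  multiples-cancel {b = b} {x} x∉ (suc c) (suc d) u v eq =
    map₁ (≡.cong suc) (multiples-cancel x∉ c d u v (∙-cancelˡ x _ _ (begin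
      x ∙ (c · x ∙ lin u b)   ≈⟨ assoc _ _ _ ⟨
      (x ∙ c · x) ∙ lin u b   ≈⟨ eq ⟩
      (x ∙ d · x) ∙ lin v b   ≈⟨ assoc _ _ _ ⟩
      x ∙ (d · x ∙ lin v b)   ∎)))

  independent-∷ : ∀ {r} {b : Vec Carrier r} {x} →
                  Independent b → ¬ InRationalSpan b x → Independent (x ∷ b)
  independent-∷ ind x∉ (c ∷ u) (d ∷ v) eq with multiples-cancel x∉ c d u v eq
  ... | c≡d , u≈v = ≡.cong₂ _∷_ c≡d (ind u v u≈v)

  rescale : ∀ {r} {b : Vec Carrier r} {x} q p u v w → p · x ∙ lin u b ≈ lin v b →
            (q * p) · x ∙ lin (q ·ᵥ u +ᵥ w) b ≈ lin (q ·ᵥ v +ᵥ w) b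
  rescale {b = b} {x} q p u v w eq = begin
    (q * p) · x ∙ lin (q ·ᵥ u +ᵥ w) b        ≈⟨ ∙-cong (sym (×-assocˡ x q p)) (lin-+ (q ·ᵥ u) w b) ⟩
    q · (p · x) ∙ (lin (q ·ᵥ u) b ∙ lin w b) ≈⟨ assoc _ _ _ ⟨
    (q · (p · x) ∙ lin (q ·ᵥ u) b) ∙ lin w b ≈⟨ ∙-congʳ (∙-congˡ (lin-· q u b)) ⟩
    (q · (p · x) ∙ q · lin u b) ∙ lin w b    ≈⟨ ∙-congʳ (×-distrib-+ (p · x) (lin u b) q) ⟨
    q · (p · x ∙ lin u b) ∙ lin w b          ≈⟨ ∙-congʳ (×-congʳ q eq) ⟩
    q · lin v b ∙ lin w b                    ≈⟨ ∙-congʳ (lin-· q v b) ⟨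
    lin (q ·ᵥ v) b ∙ lin w b                 ≈⟨ lin-+ (q ·ᵥ v) w b ⟨
    lin (q ·ᵥ v +ᵥ w) b                      ∎

  module _ {n} {a : Fin (suc n) → Carrier} (C : Coordinates (a ∘ suc)) where
    open Coordinates C

    extend-basis : ¬ InRationalSpan basis (a zero) → Coordinates a
    extend-basis a₀∉ = record
      { basis       = a zero ∷ basis
      ; independent = independent-∷ independent a₀∉
      ; scale       = scale
      ; shift       = 0 ∷ shift
      ; coords      = λ { zero → suc scale ∷ shift ; (suc i) → 0 ∷ coords i }
      ; represents  = λ { zero    → ∙-congˡ (identityˡ _)
                        ; (suc i) → trans (∙-congˡ (identityˡ _)) (trans (represents i) (sym (identityˡ _))) }
      }

    rescale-coordinates : InRationalSpan basis (a zero) → Coordinates a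
    rescale-coordinates (m , d , e , a₀∈) = record
      { basis       = basis
      ; independent = independent
      ; scale       = scale + m * suc scale    -- the new multiplier is (1 + m)(1 + scale)
      ; shift       = suc m ·ᵥ shift +ᵥ suc scale ·ᵥ d
      ; coords      = λ { zero    → suc scale ·ᵥ e +ᵥ suc m ·ᵥ shift
                        ; (suc i) → suc m ·ᵥ coords i +ᵥ suc scale ·ᵥ d }
      ; represents  = λ { zero    → a₀-represented
                        ; (suc i) → rescale (suc m) (suc scale) shift (coords i) (suc scale ·ᵥ d) (represents i) }
      }
      where
      a₀-represented : (suc m * suc scale) · a zero ∙ lin (suc m ·ᵥ shift +ᵥ suc scale ·ᵥ d) basis
                     ≈ lin (suc scale ·ᵥ e +ᵥ suc m ·ᵥ shift) basis
      a₀-represented = begin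
        (suc m * suc scale) · a zero ∙ lin (suc m ·ᵥ shift +ᵥ suc scale ·ᵥ d) basis
          ≡⟨ ≡.cong₂ (λ n u → n · a zero ∙ lin u basis)
                     (*-comm (suc m) (suc scale)) (+ᵥ-comm (suc m ·ᵥ shift) (suc scale ·ᵥ d)) ⟩
        (suc scale * suc m) · a zero ∙ lin (suc scale ·ᵥ d +ᵥ suc m ·ᵥ shift) basis
          ≈⟨ rescale (suc scale) (suc m) d e (suc m ·ᵥ shift) a₀∈ ⟩
        lin (suc scale ·ᵥ e +ᵥ suc m ·ᵥ shift) basis
          ∎

    extend : Dec (InRationalSpan basis (a zero)) → Coordinates a
    extend (yes a₀∈) = rescale-coordinates a₀∈
    extend (no a₀∉)  = extend-basis a₀∉

  coordinates : ∀ {n} (a : Fin n → Carrier) → ¬ ¬ Coordinates a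
  coordinates {zero}  a ¬C = ¬C record
    { basis       = []
    ; independent = λ { [] [] _ → ≡.refl }
    ; scale       = 0
    ; shift       = []
    ; coords      = λ ()
    ; represents  = λ ()
    }
  coordinates {suc n} a ¬C = coordinates (a ∘ suc) λ C → ¬¬-excluded-middle (¬C ∘ extend C)

  module Transfer (tf : TorsionFree G) {k} {a : Fin (suc k) → Carrier} (a-distinct : Distinct G a)
    (C : Coordinates a) where
    open Coordinates C
    open Sumsets (+ᵥ-isCommutativeMonoid {rank})
      using (sum; IsSumOf; SumsetEnumeration; atLeast⇒≤; atMost⇒≥; dichotomy)

    sum-coordinates : ∀ {h} (w : Fin h → Fin (suc k)) →
                      suc scale · sumFin G (a ∘ w) ∙ h · lin shift basis ≈ lin (sum (coords ∘ w)) basis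
    sum-coordinates {zero}  w = begin
      suc scale · ε ∙ ε   ≈⟨ identityʳ _ ⟩
      suc scale · ε       ≈⟨ ·-ε (suc scale) ⟩
      ε                   ≈⟨ lin-0 basis ⟨
      lin 0ᵥ basis        ∎
    sum-coordinates {suc h} w = begin
      suc scale · (a (w zero) ∙ sumFin G (a ∘ w ∘ suc)) ∙ (lin shift basis ∙ h · lin shift basis)
        ≈⟨ ∙-congʳ (×-distrib-+ _ _ (suc scale)) ⟩
      (suc scale · a (w zero) ∙ suc scale · sumFin G (a ∘ w ∘ suc)) ∙ (lin shift basis ∙ h · lin shift basis)
        ≈⟨ interchange _ _ _ _ ⟩
      (suc scale · a (w zero) ∙ lin shift basis) ∙ (suc scale · sumFin G (a ∘ w ∘ suc) ∙ h · lin shift basis)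
        ≈⟨ ∙-cong (represents (w zero)) (sum-coordinates (w ∘ suc)) ⟩
      lin (coords (w zero)) basis ∙ lin (sum (coords ∘ w ∘ suc)) basis
        ≈⟨ lin-+ (coords (w zero)) _ basis ⟨
      lin (coords (w zero) +ᵥ sum (coords ∘ w ∘ suc)) basis
        ∎

    sums-≈⇒coords-≡ : ∀ {h} (w w′ : Fin h → Fin (suc k)) →
                      sumFin G (a ∘ w) ≈ sumFin G (a ∘ w′) → sum (coords ∘ w) ≡ sum (coords ∘ w′)
    sums-≈⇒coords-≡ {h} w w′ eq = independent _ _ (begin
      lin (sum (coords ∘ w)) basis                          ≈⟨ sum-coordinates w ⟨
      suc scale · sumFin G (a ∘ w) ∙ h · lin shift basis    ≈⟨ ∙-congʳ (×-congʳ (suc scale) eq) ⟩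
      suc scale · sumFin G (a ∘ w′) ∙ h · lin shift basis   ≈⟨ sum-coordinates w′ ⟩
      lin (sum (coords ∘ w′)) basis                         ∎)

    coords-≡⇒sums-≈ : ∀ {h} (w w′ : Fin h → Fin (suc k)) →
                      sum (coords ∘ w) ≡ sum (coords ∘ w′) → ¬ ¬ sumFin G (a ∘ w) ≈ sumFin G (a ∘ w′)
    coords-≡⇒sums-≈ {h} w w′ eq = ·-injective tf scale (∙-cancelʳ (h · lin shift basis) _ _ (begin
      suc scale · sumFin G (a ∘ w) ∙ h · lin shift basis    ≈⟨ sum-coordinates w ⟩
      lin (sum (coords ∘ w)) basis                          ≡⟨ ≡.cong (λ u → lin u basis) eq ⟩
      lin (sum (coords ∘ w′)) basis                         ≈⟨ sum-coordinates w′ ⟨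
      suc scale · sumFin G (a ∘ w′) ∙ h · lin shift basis   ∎))

    coords-injective : Injective _≡_ _≡_ coords
    coords-injective {i} {j} eq = decidable-stable (i ≟ᶠ j) (¬¬-map (a-distinct i j)
      (·-injective tf scale (∙-cancelʳ (lin shift basis) _ _ (begin
        suc scale · a i ∙ lin shift basis   ≈⟨ represents i ⟩
        lin (coords i) basis                ≡⟨ ≡.cong (λ u → lin u basis) eq ⟩
        lin (coords j) basis                ≈⟨ represents j ⟨
        suc scale · a j ∙ lin shift basis   ∎))))

    sumsetEnumeration : ∀ {h m} → HasCard G (InSumset G h a) m → SumsetEnumeration coords h m
    sumsetEnumeration {h} {m} (e , e-injective , e∈ , e-complete) = record
      { element   = element
      ; injective = injective
      ; sound     = λ i → word i , ≡.refl
      ; complete  = complete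
      }
      where
      word : Fin m → Fin h → Fin (suc k)
      word i = proj₁ (e∈ i)

      element : Fin m → Vec ℕ rank
      element i = sum (coords ∘ word i)

      injective : Injective _≡_ _≡_ element
      injective {i} {j} eq = decidable-stable (i ≟ᶠ j) (¬¬-map
        (λ sums≈ → e-injective i j (trans (proj₂ (e∈ i)) (trans sums≈ (sym (proj₂ (e∈ j))))))
        (coords-≡⇒sums-≈ (word i) (word j) eq))

      complete : ∀ {v} → IsSumOf coords h v → ∃ λ i → v ≡ element i
      complete (w , ≡.refl) with e-complete (sumFin G (a ∘ w)) (w , refl)
      ... | i , sum≈ei = i , sums-≈⇒coords-≡ w (word i) (trans sum≈ei (proj₂ (e∈ i)))

    sumset-size-dichotomy : ∀ h {m} → HasCard G (InSumset G (suc h) a) m →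
                            suc h * suc k ≤ m ⊎ m ≤ suc (suc h * k)
    sumset-size-dichotomy h card =
      Sum.map (atLeast⇒≤ coords E) (atMost⇒≥ coords E) (dichotomy lexicographic coords coords-injective h)
      where E = sumsetEnumeration card

window-empty : ∀ h k {m} → suc h * suc k ∸ suc h + 2 ≤ m → m ≤ suc h * suc k ∸ 1 →
               ¬ (suc h * suc k ≤ m ⊎ m ≤ suc (suc h * k))
window-empty h k lower upper (inj₁ hk≤m) = ℕₚ.<-irrefl ≡.refl (ℕₚ.≤-trans hk≤m upper)
window-empty h k {m} lower upper (inj₂ m≤) = ℕₚ.<-irrefl ≡.refl (begin-strict
  suc (suc h * k)             <⟨ ℕₚ.n<1+n _ ⟩
  2 + suc h * k               ≡⟨ +-comm 2 (suc h * k) ⟩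
  suc h * k + 2               ≡⟨ ≡.cong (_+ 2) (≡.sym h[k+1]-h≡hk) ⟩
  suc h * suc k ∸ suc h + 2   ≤⟨ lower ⟩
  m                           ≤⟨ m≤ ⟩
  suc (suc h * k)             ∎)
  where
  open ℕₚ.≤-Reasoning
  h[k+1]-h≡hk : suc h * suc k ∸ suc h ≡ suc h * k
  h[k+1]-h≡hk = ≡.trans (≡.cong (_∸ suc h) (ℕₚ.*-suc (suc h) k)) (ℕₚ.m+n∸m≡n (suc h) (suc h * k))

theorem3p6 : ∀ {c ℓ : Level} (G : AbelianGroup c ℓ) → TorsionFree G →
    ∀ (h k : ℕ) → 2 ≤ h → 4 ≤ k →
    ∀ (a : Fin k → AbelianGroup.Carrier G) → Distinct G a →
    ∀ (m : ℕ) → HasCard G (InSumset G h a) m →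
    ¬ ((h * k ∸ h) + 2 ≤ m × m ≤ h * k ∸ 1)
-- 2 ≤ h and 4 ≤ k are used only to exclude h = 0 and k = 0.
theorem3p6 G tf zero    k       () _ a a-distinct m card
theorem3p6 G tf (suc h) zero    _ () a a-distinct m card
theorem3p6 G tf (suc h) (suc k) _ _  a a-distinct m card (lower , upper) =
  coordinates G a λ C →
    window-empty h k lower upper (Transfer.sumset-size-dichotomy G tf a-distinct C h card)
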